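{- Let $M \geq 2$ be square-free, $K = \mathbb{Q}(\sqrt M)$ with ring of integers $\mathbf{Z}_K$, fundamental unit $\varepsilon_M$ and $\mathbf{S} = \mathbf{N}(\varepsilon_M)$. Let $s \in \{ -1,1\}$ and $\nu \in \mathbb{Z}_{\geq 2}$. (i) A fundamental solution of the norm equation $u^2 - M v^2 = 4 s \nu$ exists if and only if there exists an integral principal ideal $\mathfrak{a}$ of $\mathbf{Z}_K$ of absolute norm $\nu$ having a generator $\alpha \in \mathbf{Z}_K^+$ whose norm has sign $s$. Moreover, suppose $\mathfrak{a} = (\alpha)$ is an integral ideal of absolute norm $\nu$ with $\alpha \in \mathbf{Z}_K^+$ and $\mathbf{N}(\alpha) = s'\nu$: if $\mathbf{S} = -1$, then for either sign $s$ there is a generator of $\mathfrak a$ in $\mathbf{Z}_K^+$ (a representative modulo $\langle \varepsilon_M \rangle$) of norm $s\nu$; if $\mathbf{S} = 1$, a generator of $\mathfrak a$ in $\mathbf{Z}_K^+$ of norm $s\nu$ exists if and only if $s' = s$. (ii) When these conditions are fulfilled, the fundamental solution corresponding to $\mathfrak{a}$ is unique, in the sense that two generators of $\mathfrak{a}$ lying in $\mathbf{Z}_K^+$ and having the same trace are equal; and the fundamental solution is the one found by the first-occurrence process, namely its trace $u$ is the least integer $t \geq 1$ such that the square-free part of $t^2 - 4s\nu$ equals $M$, and it equals $\frac12(u + r\sqrt M)$ where $u^2 - 4s\nu = M r^2$, $r \geq 1$.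
   Context: $\mathbf{N}$ and $\mathbf{T}$ denote norm and trace of $K/\mathbb{Q}$. $\mathbf{Z}_K^+ := \{\frac12(u + v\sqrt M) : u, v \in \mathbb{Z}_{\geq 1},\ u \equiv v \pmod 2\} \cap \mathbf{Z}_K$ (integers of $K$ with positive coefficients on $\{1,\sqrt M\}$). For $\alpha = \frac12(u+v\sqrt M)$, $\mathbf{T}(\alpha)=u$ and $\mathbf{N}(\alpha)=\frac14(u^2-Mv^2)$. A fundamental solution of $u^2 - Mv^2 = 4s\nu$ with $u,v \in \mathbb{Z}_{\geq 1}$ is the corresponding $\alpha = \frac12(u+v\sqrt M) \in \mathbf{Z}_K^+$ (of norm $s\nu$) of minimal trace $u$. -}

module Defs where

open import Data.Nat as ℕ using (ℕ)
open import Data.Nat.Divisibility as ℕ∣ using ()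
open import Data.Integer as ℤ using (ℤ; +_; -_; _+_; _-_; _*_; _≤_; _<_; ∣_∣; sign; 1ℤ; -1ℤ)
open import Data.Integer.Divisibility as ℤ∣ using ()
open import Data.Product using (Σ; _×_)
open import Data.Sum using (_⊎_)
open import Relation.Binary.PropositionalEquality using (_≡_)
open import Function.Bundles using (_⇔_)

SquareFree : ℕ → Set
SquareFree n = (d : ℕ) → d ℕ.* d ℕ∣.∣ n → d ≡ 1

-- Elements of K = Q(√M) written as α = (u + v√M)/2 with u v : ℤ.
record 𝕂 : Set where
  constructor ⟨_,_⟩
  field
    u : ℤ
    v : ℤ
open 𝕂 public

module QF (M : ℕ) where

  4N : 𝕂 → ℤ
  4N α = u α * u α - + M * (v α * v α)

  T : 𝕂 → ℤ
  T α = u α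

  N : 𝕂 → ℤ
  N α = 4N α ℤ./ + 4

  -- α ∈ Z_K  iff  T(α) and N(α) are integers, i.e. u ≡ v (mod 2) and 4 ∣ u² − M v²
  InZK : 𝕂 → Set
  InZK α = (+ 2 ℤ∣.∣ (u α - v α)) × (+ 4 ℤ∣.∣ 4N α)

  InZK⁺ : 𝕂 → Set
  InZK⁺ α = InZK α × (+ 1 ≤ u α) × (+ 1 ≤ v α)

  -- γ = α · β  in K (written without division)
  IsProduct : 𝕂 → 𝕂 → 𝕂 → Set
  IsProduct α β γ =
    (+ 2 * u γ ≡ u α * u β + + M * (v α * v β)) ×
    (+ 2 * v γ ≡ u α * v β + v α * u β)

  _∣K_ : 𝕂 → 𝕂 → Set
  α ∣K β = Σ 𝕂 λ x → InZK x × IsProduct α x β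

  Generates : 𝕂 → 𝕂 → Set
  Generates α β = (α ∣K β) × (β ∣K α)

  idealNorm : 𝕂 → ℕ
  idealNorm α = ∣ N α ∣

  one : 𝕂
  one = ⟨ + 2 , + 0 ⟩

  IsUnit : 𝕂 → Set
  IsUnit η = InZK η × (η ∣K one)

  -- fundamental unit ε_M : the least unit > 1.  Units > 1 are exactly the units in
  -- Z_K^+, and among these the order by size coincides with the order by trace.
  IsFundamentalUnit : 𝕂 → Set
  IsFundamentalUnit ε =
    IsUnit ε × InZK⁺ ε × ((η : 𝕂) → IsUnit η → InZK⁺ η → T ε ≤ T η)

  IsSolution : ℤ → ℕ → ℤ → ℤ → Set
  IsSolution s ν x y = (+ 1 ≤ x) × (+ 1 ≤ y) × (x * x - + M * (y * y) ≡ + 4 * (s * + ν))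

  IsFundamentalSolution : ℤ → ℕ → ℤ → ℤ → Set
  IsFundamentalSolution s ν x y =
    IsSolution s ν x y × ((x' y' : ℤ) → IsSolution s ν x' y' → x ≤ x')

IsSqfreePart : ℤ → ℤ → Set
IsSqfreePart m d = SquareFree ∣ d ∣ × Σ ℕ λ k → (1 ℕ.≤ k) × (m ≡ d * (+ k * + k))

IsFirstOccurrence : ℕ → ℤ → ℕ → ℤ → Set
IsFirstOccurrence M s ν t =
  (+ 1 ≤ t) × IsSqfreePart (t * t - + 4 * (s * + ν)) (+ M) ×
  ((t' : ℤ) → + 1 ≤ t' → IsSqfreePart (t' * t' - + 4 * (s * + ν)) (+ M) → t ≤ t')

{-# OPTIONS --safe #-}
-- A solution (u, v), u, v ≥ 1, of u² − M v² = 4 s ν is the same thing as an element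
-- α = (u + v√M)/2 of Z_K^+ of norm s ν: since M is square-free, u ≡ v (mod 2).  Associated
-- elements have the same absolute norm, and for fixed u there are finitely many v, so
-- the least admissible u (the fundamental solution) can be found by search.  Multiplying
-- by ε_M keeps α in Z_K^+ and multiplies its norm by S, which settles S = −1.  For S = 1
-- there is no element of norm −1 at all: if η ∈ Z_K^+ had norm −1 and least trace, then
-- T ε_M ≤ T η, and η ε̄_M would again lie in Z_K^+, have norm −1 and have smaller trace.
-- Finally trace and norm determine v² and hence an element of Z_K^+, which gives (ii).
module Submission where

open import Defs
open import Data.Nat as ℕ using (ℕ)
import Data.Nat.Properties as ℕ
import Data.Nat.DivMod as ℕ
import Data.Nat.Divisibility as ℕ
open import Data.Nat.Induction using (<-rec)
open import Data.Integer as ℤ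
  using (ℤ; +_; -_; _+_; _-_; _*_; _≤_; _<_; ∣_∣; sign; 1ℤ; -1ℤ; 0ℤ; +[1+_]; -[1+_]; +≤+; +<+)
open import Data.Integer.Properties
open import Data.Integer.DivMod using (a≡a%n+[a/n]*n; n%d<d)
import Data.Integer.Divisibility.Signed as S
open import Data.Integer.Tactic.RingSolver using (solve)
open import Algebra.Properties.CommutativeSemigroup *-commutativeSemigroup using (interchange)
open import Data.List using (_∷_; [])
open import Data.Product using (Σ; ∃; ∃₂; _×_; _,_; proj₁; proj₂)
open import Data.Sum using (_⊎_; inj₁; inj₂)
open import Relation.Nullary using (¬_; yes; no; Dec; contradiction)
open import Relation.Nullary.Decidable using (_×-dec_)
open import Relation.Unary using (Decidable)
open import Function.Base using (_∋_)
open import Function.Bundles using (_⇔_; mk⇔)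
open import Relation.Binary.PropositionalEquality
open ≡-Reasoning

private variable
  i j k s s' : ℤ

0<2 : 0ℤ < + 2
0<2 = +<+ (ℕ.s≤s ℕ.z≤n)

0<4 : 0ℤ < + 4
0<4 = +<+ (ℕ.s≤s ℕ.z≤n)

pos*pos⇒pos : 0ℤ < i → 0ℤ < j → 0ℤ < i * j
pos*pos⇒pos {i} 0<i 0<j = subst (_< i * _) (*-zeroʳ i) (*-monoˡ-<-pos i {{ℤ.positive 0<i}} 0<j)

nonNeg*nonNeg⇒nonNeg : 0ℤ ≤ i → 0ℤ ≤ j → 0ℤ ≤ i * j
nonNeg*nonNeg⇒nonNeg {+ m} {+ n} _ _ = subst (0ℤ ≤_) (pos-* m n) (+≤+ ℕ.z≤n)

pos+nonNeg⇒pos : 0ℤ < i → 0ℤ ≤ j → 0ℤ < i + j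
pos+nonNeg⇒pos 0<i 0≤j = +-mono-<-≤ 0<i 0≤j

i*i≥0 : ∀ i → 0ℤ ≤ i * i
i*i≥0 (+ n)      = nonNeg*nonNeg⇒nonNeg {+ n} {+ n} (+≤+ ℕ.z≤n) (+≤+ ℕ.z≤n)
i*i≥0 -[1+ n ]   = +≤+ ℕ.z≤n

*-cancelʳ-pos : 0ℤ < j → 0ℤ < i * j → 0ℤ < i
*-cancelʳ-pos {j} 0<j 0<ij = *-cancelʳ-<-nonNeg j {{ℤ.nonNegative (<⇒≤ 0<j)}} 0<ij

*-cancelˡ-pos : 0ℤ < i → 0ℤ < i * j → 0ℤ < j
*-cancelˡ-pos {i} {j} 0<i 0<ij = *-cancelʳ-pos 0<i (subst (0ℤ <_) (*-comm i j) 0<ij)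

0<i-j⇒j<i : 0ℤ < i - j → j < i
0<i-j⇒j<i {i} {j} 0<i-j =
  subst₂ _<_ (+-identityʳ j) ((j + (i - j) ≡ i) ∋ solve (i ∷ j ∷ [])) (+-monoʳ-< j 0<i-j)

∣i∣*∣i∣≡i*i : ∀ i → + ∣ i ∣ * + ∣ i ∣ ≡ i * i
∣i∣*∣i∣≡i*i (+ n)    = refl
∣i∣*∣i∣≡i*i -[1+ n ] = refl

square-injective : 0ℤ < i → 0ℤ < j → i * i ≡ j * j → i ≡ j
square-injective {i} {j} 0<i 0<j i²≡j² with i*j≡0⇒i≡0∨j≡0 (i - j) difference-of-squares
  where
  difference-of-squares : (i - j) * (i + j) ≡ 0ℤ
  difference-of-squares = begin
    (i - j) * (i + j) ≡⟨ solve (i ∷ j ∷ []) ⟩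
    i * i - j * j     ≡⟨ i≡j⇒i-j≡0 i²≡j² ⟩
    0ℤ                ∎
... | inj₁ i-j≡0 = i-j≡0⇒i≡j i j i-j≡0
... | inj₂ i+j≡0 = contradiction (subst (0ℤ <_) i+j≡0 (pos+nonNeg⇒pos 0<i (<⇒≤ 0<j))) (<-irrefl refl)

1≤∣i∣ : ∀ i → i ≢ 0ℤ → + 1 ≤ + ∣ i ∣
1≤∣i∣ (+ 0)      i≢0 = contradiction refl i≢0
1≤∣i∣ +[1+ _ ]   _   = +≤+ (ℕ.s≤s ℕ.z≤n)
1≤∣i∣ -[1+ _ ]   _   = +≤+ (ℕ.s≤s ℕ.z≤n)

i-j≡k⇒i≡j+k : i - j ≡ k → i ≡ j + k
i-j≡k⇒i≡j+k {i} {j} refl = solve (i ∷ j ∷ [])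

i-j≡k⇒j≡i-k : i - j ≡ k → j ≡ i - k
i-j≡k⇒j≡i-k {i} {j} refl = solve (i ∷ j ∷ [])

i*4/4≡i : ∀ i → i * + 4 ℤ./ + 4 ≡ i
i*4/4≡i (+ n) rewrite sym (pos-* n 4) =
  trans (*-identityˡ _) (cong +_ (ℕ.m*n/n≡m n 4))
i*4/4≡i -[1+ n ] rewrite ℕ.m*n%n≡0 (ℕ.suc n) 4 {{_}} =
  trans (*-identityˡ _) (cong (λ k → - (+ k)) (ℕ.m*n/n≡m (ℕ.suc n) 4))

even⊎odd : ∀ i → Σ ℤ λ k → i ≡ k * + 2 ⊎ i ≡ k * + 2 + + 1
even⊎odd i with i ℤ.% + 2 | a≡a%n+[a/n]*n i (+ 2) | n%d<d i (+ 2)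
... | 0 | i≡ | _ = i ℤ./ + 2 , inj₁ (trans i≡ (+-identityˡ (i ℤ./ + 2 * + 2)))
... | 1 | i≡ | _ = i ℤ./ + 2 , inj₂ (trans i≡ (+-comm (+ 1) (i ℤ./ + 2 * + 2)))
... | ℕ.suc (ℕ.suc _) | _ | ℕ.s≤s (ℕ.s≤s ())

IsSign : ℤ → Set
IsSign s = s ≡ 1ℤ ⊎ s ≡ -1ℤ

sign-dichotomy : IsSign s → IsSign s' → s' ≡ s ⊎ s ≡ - s'
sign-dichotomy (inj₁ refl) (inj₁ refl) = inj₁ refl
sign-dichotomy (inj₂ refl) (inj₂ refl) = inj₁ refl
sign-dichotomy (inj₁ refl) (inj₂ refl) = inj₂ refl
sign-dichotomy (inj₂ refl) (inj₁ refl) = inj₂ refl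

∣s*ν∣≡ν : IsSign s → ∀ ν → ∣ s * + ν ∣ ≡ ν
∣s*ν∣≡ν (inj₁ refl) ν = cong ∣_∣ (*-identityˡ (+ ν))
∣s*ν∣≡ν (inj₂ refl) ν = trans (cong ∣_∣ (-1*i≡-i (+ ν))) (∣-i∣≡∣i∣ (+ ν))

sign[s*ν]≡sign[s] : IsSign s → ∀ ν .{{_ : ℕ.NonZero ν}} → sign (s * + ν) ≡ sign s
sign[s*ν]≡sign[s] (inj₁ refl) ν          = cong sign (*-identityˡ (+ ν))
sign[s*ν]≡sign[s] (inj₂ refl) (ℕ.suc n)  = cong sign (-1*i≡-i (+ ℕ.suc n))

sign[s]◃ν≡s*ν : IsSign s → ∀ ν → sign s ℤ.◃ ν ≡ s * + ν
sign[s]◃ν≡s*ν (inj₁ refl) ν = trans (+◃n≡+n ν) (sym (*-identityˡ (+ ν)))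
sign[s]◃ν≡s*ν (inj₂ refl) ν = trans (-◃n≡-n ν) (sym (-1*i≡-i (+ ν)))

IsLeast : (ℕ → Set) → ℕ → Set
IsLeast P m = P m × (∀ {k} → P k → m ℕ.≤ k)

module _ {P : ℕ → Set} (P? : Decidable P) where

  least-witness : ∀ {n} → P n → ∃ (IsLeast P)
  least-witness {n} = <-rec (λ n → P n → ∃ (IsLeast P)) search n
    where
    search : ∀ n → (∀ {k} → k ℕ.< n → P k → ∃ (IsLeast P)) → P n → ∃ (IsLeast P)
    search n smaller pₙ with ℕ.anyUpTo? P? n
    ... | yes (k , k<n , pₖ) = smaller k<n pₖ
    ... | no ∄k<n = n , pₙ , λ {k} pₖ → ℕ.≮⇒≥ (λ k<n → ∄k<n (k , k<n , pₖ))

conj : 𝕂 → 𝕂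
conj α = ⟨ u α , - v α ⟩

-conj : 𝕂 → 𝕂
-conj α = ⟨ - u α , v α ⟩

-- Elements (u + v√m)/2 for an arbitrary integer m; norm α is 4 N(α), i.e. QF.4N at m = + M.
-- Here m is a variable, so the ring solver can treat it as an atom.
module Quadratic (m : ℤ) where

  norm : 𝕂 → ℤ
  norm α = u α * u α - m * (v α * v α)

  Product : 𝕂 → 𝕂 → 𝕂 → Set
  Product α β γ = (+ 2 * u γ ≡ u α * u β + m * (v α * v β)) × (+ 2 * v γ ≡ u α * v β + v α * u β)

  norm-* : ∀ α β γ → Product α β γ → norm γ * + 4 ≡ norm α * norm β
  norm-* ⟨ a₁ , b₁ ⟩ ⟨ a₂ , b₂ ⟩ ⟨ c , d ⟩ (2c≡ , 2d≡) = begin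
    (c * c - m * (d * d)) * + 4
      ≡⟨ solve (c ∷ d ∷ m ∷ []) ⟩
    (+ 2 * c) * (+ 2 * c) - m * ((+ 2 * d) * (+ 2 * d))
      ≡⟨ cong₂ (λ x y → x * x - m * (y * y)) 2c≡ 2d≡ ⟩
    (a₁ * a₂ + m * (b₁ * b₂)) * (a₁ * a₂ + m * (b₁ * b₂))
      - m * ((a₁ * b₂ + b₁ * a₂) * (a₁ * b₂ + b₁ * a₂))
      ≡⟨ solve (a₁ ∷ b₁ ∷ a₂ ∷ b₂ ∷ m ∷ []) ⟩
    (a₁ * a₁ - m * (b₁ * b₁)) * (a₂ * a₂ - m * (b₂ * b₂)) ∎

  norm-conj : ∀ α → norm (conj α) ≡ norm α
  norm-conj ⟨ a , b ⟩ = (a * a - m * (- b * - b) ≡ a * a - m * (b * b)) ∋ solve (a ∷ b ∷ m ∷ [])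

  norm--conj : ∀ α → norm (-conj α) ≡ norm α
  norm--conj ⟨ a , b ⟩ = (- a * - a - m * (b * b) ≡ a * a - m * (b * b)) ∋ solve (a ∷ b ∷ m ∷ [])

  norm-one : norm ⟨ + 2 , + 0 ⟩ ≡ + 1 * + 4
  norm-one = (+ 2 * + 2 - m * (+ 0 * + 0) ≡ + 1 * + 4) ∋ solve (m ∷ [])

  product-one : ∀ α → Product α ⟨ + 2 , + 0 ⟩ α
  product-one ⟨ a , b ⟩ =
    ((+ 2 * a ≡ a * + 2 + m * (b * + 0)) ∋ solve (a ∷ b ∷ m ∷ [])) ,
    ((+ 2 * b ≡ a * + 0 + b * + 2) ∋ solve (a ∷ b ∷ []))

  norm-−4⇒invertible : ∀ α → norm α ≡ - + 4 → Product α (-conj α) ⟨ + 2 , + 0 ⟩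
  norm-−4⇒invertible ⟨ a , b ⟩ norm≡ = (begin
    + 2 * + 2                       ≡⟨ cong -_ (sym norm≡) ⟩
    - (a * a - m * (b * b))         ≡⟨ solve (a ∷ b ∷ m ∷ []) ⟩
    a * - a + m * (b * b)           ∎) ,
    ((+ 2 * + 0 ≡ a * b + b * - a) ∋ solve (a ∷ b ∷ []))

  product-by-inverse : ∀ α η η⁻¹ γ → Product α η γ → Product η η⁻¹ ⟨ + 2 , + 0 ⟩ →
                       Product γ η⁻¹ α
  product-by-inverse ⟨ a , b ⟩ ⟨ e , f ⟩ ⟨ e' , f' ⟩ ⟨ c , d ⟩ (2c≡ , 2d≡) (4≡ , 0≡) =
    *-cancelˡ-≡ (+ 2) _ _ u-part , *-cancelˡ-≡ (+ 2) _ _ v-part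
    where
    u-part : + 2 * (+ 2 * a) ≡ + 2 * (c * e' + m * (d * f'))
    u-part = begin
      + 2 * (+ 2 * a)                                       ≡⟨ solve (a ∷ b ∷ m ∷ []) ⟩
      a * (+ 2 * + 2) + m * (b * (+ 2 * + 0))               ≡⟨ cong₂ (λ x y → a * x + m * (b * y)) 4≡ 0≡ ⟩
      a * (e * e' + m * (f * f')) + m * (b * (e * f' + f * e'))
        ≡⟨ solve (a ∷ b ∷ e ∷ f ∷ e' ∷ f' ∷ m ∷ []) ⟩
      (a * e + m * (b * f)) * e' + m * ((a * f + b * e) * f')
        ≡⟨ cong₂ (λ x y → x * e' + m * (y * f')) (sym 2c≡) (sym 2d≡) ⟩
      (+ 2 * c) * e' + m * ((+ 2 * d) * f')                 ≡⟨ solve (c ∷ d ∷ e' ∷ f' ∷ m ∷ []) ⟩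
      + 2 * (c * e' + m * (d * f'))                         ∎
    v-part : + 2 * (+ 2 * b) ≡ + 2 * (c * f' + d * e')
    v-part = begin
      + 2 * (+ 2 * b)                                       ≡⟨ solve (a ∷ b ∷ []) ⟩
      b * (+ 2 * + 2) + a * (+ 2 * + 0)                     ≡⟨ cong₂ (λ x y → b * x + a * y) 4≡ 0≡ ⟩
      b * (e * e' + m * (f * f')) + a * (e * f' + f * e')
        ≡⟨ solve (a ∷ b ∷ e ∷ f ∷ e' ∷ f' ∷ m ∷ []) ⟩
      (a * e + m * (b * f)) * f' + (a * f + b * e) * e'
        ≡⟨ cong₂ (λ x y → x * f' + y * e') (sym 2c≡) (sym 2d≡) ⟩
      (+ 2 * c) * f' + (+ 2 * d) * e'                       ≡⟨ solve (c ∷ d ∷ e' ∷ f' ∷ []) ⟩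
      + 2 * (c * f' + d * e')                               ∎

  v-even⊎4∣m-1 : ∀ α → + 2 S.∣ u α - v α → + 4 S.∣ norm α → + 2 S.∣ v α ⊎ + 4 S.∣ m - + 1
  v-even⊎4∣m-1 ⟨ a , b ⟩ (S.divides k a-b≡) (S.divides j norm≡) with even⊎odd b
  ... | n , inj₁ b≡ = inj₁ (S.divides n b≡)
  ... | n , inj₂ b≡ = inj₂ (S.divides (k * (k + b) - j - (m - + 1) * (n * n + n)) (begin
    m - + 1
      ≡⟨ solve (a ∷ b ∷ m ∷ []) ⟩
    (a - b) * ((a - b) + b * + 2) - (a * a - m * (b * b)) - (m - + 1) * ((b - + 1) * (b + + 1))
      ≡⟨ cong₂ (λ x y → x * (x + b * + 2) - y - (m - + 1) * ((b - + 1) * (b + + 1))) a-b≡ norm≡ ⟩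
    (k * + 2) * ((k * + 2) + b * + 2) - j * + 4 - (m - + 1) * ((b - + 1) * (b + + 1))
      ≡⟨ cong (λ x → (k * + 2) * ((k * + 2) + b * + 2) - j * + 4 - (m - + 1) * ((x - + 1) * (x + + 1))) b≡ ⟩
    (k * + 2) * ((k * + 2) + b * + 2) - j * + 4 - (m - + 1) * ((n * + 2 + + 1 - + 1) * (n * + 2 + + 1 + + 1))
      ≡⟨ solve (b ∷ k ∷ j ∷ n ∷ m ∷ []) ⟩
    (k * (k + b) - j - (m - + 1) * (n * n + n)) * + 4 ∎))

  product-positive : 0ℤ ≤ m → ∀ α β γ → + 1 ≤ u α → + 1 ≤ v α → + 1 ≤ u β → + 1 ≤ v β →
                     Product α β γ → + 1 ≤ u γ × + 1 ≤ v γ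
  product-positive 0≤m α β γ 1≤a₁ 1≤b₁ 1≤a₂ 1≤b₂ (2c≡ , 2d≡) =
    i<j⇒suc[i]≤j (*-cancelˡ-pos 0<2 (subst (0ℤ <_) (sym 2c≡) 0<2c)) ,
    i<j⇒suc[i]≤j (*-cancelˡ-pos 0<2 (subst (0ℤ <_) (sym 2d≡) 0<2d))
    where
    0<2c : 0ℤ < u α * u β + m * (v α * v β)
    0<2c = pos+nonNeg⇒pos (pos*pos⇒pos (suc[i]≤j⇒i<j 1≤a₁) (suc[i]≤j⇒i<j 1≤a₂))
             (nonNeg*nonNeg⇒nonNeg 0≤m
               (<⇒≤ (pos*pos⇒pos (suc[i]≤j⇒i<j 1≤b₁) (suc[i]≤j⇒i<j 1≤b₂))))
    0<2d : 0ℤ < u α * v β + v α * u β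
    0<2d = pos+nonNeg⇒pos (pos*pos⇒pos (suc[i]≤j⇒i<j 1≤a₁) (suc[i]≤j⇒i<j 1≤b₂))
             (<⇒≤ (pos*pos⇒pos (suc[i]≤j⇒i<j 1≤b₁) (suc[i]≤j⇒i<j 1≤a₂)))

  half-product : ∀ α β k₁ k₂ t → u α ≡ v α + k₁ * + 2 → u β ≡ v β + k₂ * + 2 →
                 (m - + 1) * (v α * v β) ≡ t * + 4 →
                 ∃ λ γ → Product α β γ × (u γ - v γ ≡ (t + k₁ * k₂) * + 2)
  half-product ⟨ _ , b₁ ⟩ ⟨ _ , b₂ ⟩ k₁ k₂ t refl refl [m-1]b₁b₂≡ =
    ⟨ b₁ * b₂ + k₁ * b₂ + k₂ * b₁ + (t + k₁ * k₂) * + 2 , b₁ * b₂ + k₁ * b₂ + k₂ * b₁ ⟩ ,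
    (2c≡ , solve (b₁ ∷ b₂ ∷ k₁ ∷ k₂ ∷ [])) , solve (b₁ ∷ b₂ ∷ k₁ ∷ k₂ ∷ t ∷ [])
    where
    2c≡ : + 2 * (b₁ * b₂ + k₁ * b₂ + k₂ * b₁ + (t + k₁ * k₂) * + 2) ≡
          (b₁ + k₁ * + 2) * (b₂ + k₂ * + 2) + m * (b₁ * b₂)
    2c≡ = begin
      + 2 * (b₁ * b₂ + k₁ * b₂ + k₂ * b₁ + (t + k₁ * k₂) * + 2)
        ≡⟨ solve (b₁ ∷ b₂ ∷ k₁ ∷ k₂ ∷ t ∷ []) ⟩
      (b₁ + k₁ * + 2) * (b₂ + k₂ * + 2) + b₁ * b₂ + t * + 4
        ≡⟨ cong (λ x → (b₁ + k₁ * + 2) * (b₂ + k₂ * + 2) + b₁ * b₂ + x) (sym [m-1]b₁b₂≡) ⟩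
      (b₁ + k₁ * + 2) * (b₂ + k₂ * + 2) + b₁ * b₂ + (m - + 1) * (b₁ * b₂)
        ≡⟨ solve (b₁ ∷ b₂ ∷ k₁ ∷ k₂ ∷ m ∷ []) ⟩
      (b₁ + k₁ * + 2) * (b₂ + k₂ * + 2) + m * (b₁ * b₂) ∎

  solution-parity : ¬ (+ 4 S.∣ m) → ∀ α → + 4 S.∣ norm α → + 2 S.∣ u α - v α
  solution-parity 4∤m ⟨ x , y ⟩ (S.divides j norm≡) with even⊎odd x | even⊎odd y
  ... | a , inj₁ refl | b , inj₁ refl = S.divides (a - b) (begin
    a * + 2 - b * + 2                 ≡⟨ solve (a ∷ b ∷ []) ⟩
    (a - b) * + 2                     ∎)
  ... | a , inj₂ refl | b , inj₂ refl = S.divides (a - b) (begin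
    (a * + 2 + + 1) - (b * + 2 + + 1) ≡⟨ solve (a ∷ b ∷ []) ⟩
    (a - b) * + 2                     ∎)
  ... | a , inj₁ refl | b , inj₂ refl = contradiction (S.divides (a * a - m * (b * b + b) - j) (begin
    m
      ≡⟨ solve (a ∷ b ∷ m ∷ []) ⟩
    (a * a - m * (b * b + b)) * + 4 - ((a * + 2) * (a * + 2) - m * ((b * + 2 + + 1) * (b * + 2 + + 1)))
      ≡⟨ cong (λ x → (a * a - m * (b * b + b)) * + 4 - x) norm≡ ⟩
    (a * a - m * (b * b + b)) * + 4 - j * + 4
      ≡⟨ solve (a ∷ b ∷ j ∷ m ∷ []) ⟩
    (a * a - m * (b * b + b) - j) * + 4 ∎)) 4∤m
  ... | a , inj₂ refl | b , inj₁ refl = contradiction (S.divides (j - a * a - a + m * (b * b)) (begin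
    + 1
      ≡⟨ solve (a ∷ b ∷ m ∷ []) ⟩
    (a * + 2 + + 1) * (a * + 2 + + 1) - m * ((b * + 2) * (b * + 2)) - (a * a + a - m * (b * b)) * + 4
      ≡⟨ cong (λ x → x - (a * a + a - m * (b * b)) * + 4) norm≡ ⟩
    j * + 4 - (a * a + a - m * (b * b)) * + 4
      ≡⟨ solve (a ∷ b ∷ j ∷ m ∷ []) ⟩
    (j - a * a - a + m * (b * b)) * + 4 ∎)) 4∤1
    where
    4∤1 : ¬ (+ 4 S.∣ + 1)
    4∤1 4∣1 with ℕ.∣⇒≤ (S.∣⇒∣ᵤ 4∣1)
    ... | ℕ.s≤s ()

  -- η = (a + b√m)/2 of norm −1 and ε = (p + q√m)/2 of norm 1 with p ≤ a: the product
  -- η ε̄ = (c + d√m)/2 has c, d > 0 and c < a.  Each inequality comes from an identity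
  -- x · (positive) = (positive), obtained by eliminating m b² = a² + 4 and m q² = p² − 4.
  module Descent (0<m : 0ℤ < m) (a b p q c d : ℤ) (0<b : 0ℤ < b) (0<p : 0ℤ < p) (0<q : 0ℤ < q) (p≤a : p ≤ a)
           (normᵃ≡ : a * a - m * (b * b) ≡ - + 4) (normᵖ≡ : p * p - m * (q * q) ≡ + 4)
           (product : Product ⟨ a , b ⟩ ⟨ p , - q ⟩ ⟨ c , d ⟩) where

    private
      0<a : 0ℤ < a
      0<a = <-≤-trans 0<p p≤a

      0<mbq : 0ℤ < m * (b * q)
      0<mbq = pos*pos⇒pos 0<m (pos*pos⇒pos 0<b 0<q)

      p>2 : 0ℤ < p - + 2
      p>2 = *-cancelʳ-pos (pos+nonNeg⇒pos 0<p (+≤+ ℕ.z≤n))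
              (subst (0ℤ <_) (sym p²-4≡) (pos*pos⇒pos 0<m (pos*pos⇒pos 0<q 0<q)))
        where
        p²-4≡ : (p - + 2) * (p + + 2) ≡ m * (q * q)
        p²-4≡ = begin
          (p - + 2) * (p + + 2)                ≡⟨ solve (p ∷ q ∷ m ∷ []) ⟩
          (p * p - m * (q * q)) - + 4 + m * (q * q) ≡⟨ cong (λ x → x - + 4 + m * (q * q)) normᵖ≡ ⟩
          + 4 - + 4 + m * (q * q)              ≡⟨ solve (q ∷ m ∷ []) ⟩
          m * (q * q)                          ∎

    c>0 : 0ℤ < c
    c>0 = *-cancelʳ-pos 0<2Y (subst (0ℤ <_) (sym identity) 0<rhs)
      where
      0<2Y : 0ℤ < + 2 * (a * p + m * (b * q))
      0<2Y = pos*pos⇒pos 0<2 (pos+nonNeg⇒pos (pos*pos⇒pos 0<a 0<p) (<⇒≤ 0<mbq))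
      0<rhs : 0ℤ < (+ 4 + (a - p) * (a + p)) * + 4
      0<rhs = pos*pos⇒pos (pos+nonNeg⇒pos 0<4
                (nonNeg*nonNeg⇒nonNeg (i≤j⇒0≤j-i p≤a) (<⇒≤ (pos+nonNeg⇒pos 0<a (<⇒≤ 0<p))))) 0<4
      identity : c * (+ 2 * (a * p + m * (b * q))) ≡ (+ 4 + (a - p) * (a + p)) * + 4
      identity = begin
        c * (+ 2 * (a * p + m * (b * q)))
          ≡⟨ solve (a ∷ b ∷ p ∷ q ∷ c ∷ m ∷ []) ⟩
        (+ 2 * c) * (a * p + m * (b * q))
          ≡⟨ cong (_* (a * p + m * (b * q))) (proj₁ product) ⟩
        (a * p + m * (b * - q)) * (a * p + m * (b * q))
          ≡⟨ solve (a ∷ b ∷ p ∷ q ∷ m ∷ []) ⟩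
        a * a * (p * p - m * (q * q)) + p * p * (a * a - m * (b * b)) - (a * a - m * (b * b)) * (p * p - m * (q * q))
          ≡⟨ cong₂ (λ x y → a * a * y + p * p * x - x * y) normᵃ≡ normᵖ≡ ⟩
        a * a * + 4 + p * p * - + 4 - - + 4 * + 4
          ≡⟨ solve (a ∷ p ∷ []) ⟩
        (+ 4 + (a - p) * (a + p)) * + 4 ∎

    d>0 : 0ℤ < d
    d>0 = *-cancelʳ-pos 0<2Y (subst (0ℤ <_) (sym identity) 0<rhs)
      where
      0<2Y : 0ℤ < + 2 * (b * p + a * q)
      0<2Y = pos*pos⇒pos 0<2 (pos+nonNeg⇒pos (pos*pos⇒pos 0<b 0<p) (<⇒≤ (pos*pos⇒pos 0<a 0<q)))
      0<rhs : 0ℤ < (b * b + q * q) * + 4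
      0<rhs = pos*pos⇒pos (pos+nonNeg⇒pos (pos*pos⇒pos 0<b 0<b) (i*i≥0 q)) 0<4
      identity : d * (+ 2 * (b * p + a * q)) ≡ (b * b + q * q) * + 4
      identity = begin
        d * (+ 2 * (b * p + a * q))
          ≡⟨ solve (a ∷ b ∷ p ∷ q ∷ d ∷ []) ⟩
        (+ 2 * d) * (b * p + a * q)
          ≡⟨ cong (_* (b * p + a * q)) (proj₂ product) ⟩
        (a * - q + b * p) * (b * p + a * q)
          ≡⟨ solve (a ∷ b ∷ p ∷ q ∷ m ∷ []) ⟩
        b * b * (p * p - m * (q * q)) - q * q * (a * a - m * (b * b))
          ≡⟨ cong₂ (λ x y → b * b * y - q * q * x) normᵃ≡ normᵖ≡ ⟩
        b * b * + 4 - q * q * - + 4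
          ≡⟨ solve (b ∷ q ∷ []) ⟩
        (b * b + q * q) * + 4 ∎

    c<a : c < a
    c<a = 0<i-j⇒j<i (*-cancelʳ-pos 0<2Y (subst (0ℤ <_) (sym identity) 0<rhs))
      where
      0<2Y : 0ℤ < + 2 * (m * (b * q) + a * (p - + 2))
      0<2Y = pos*pos⇒pos 0<2 (pos+nonNeg⇒pos 0<mbq (<⇒≤ (pos*pos⇒pos 0<a p>2)))
      0<rhs : 0ℤ < (p - + 2) * (p + + 2 + a * a) * + 4
      0<rhs = pos*pos⇒pos (pos*pos⇒pos p>2 (pos+nonNeg⇒pos (pos+nonNeg⇒pos 0<p (+≤+ ℕ.z≤n)) (i*i≥0 a))) 0<4
      identity : (a - c) * (+ 2 * (m * (b * q) + a * (p - + 2))) ≡ (p - + 2) * (p + + 2 + a * a) * + 4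
      identity = begin
        (a - c) * (+ 2 * (m * (b * q) + a * (p - + 2)))
          ≡⟨ solve (a ∷ b ∷ p ∷ q ∷ c ∷ m ∷ []) ⟩
        (+ 2 * a - + 2 * c) * (m * (b * q) + a * (p - + 2))
          ≡⟨ cong (λ x → (+ 2 * a - x) * (m * (b * q) + a * (p - + 2))) (proj₁ product) ⟩
        (+ 2 * a - (a * p + m * (b * - q))) * (m * (b * q) + a * (p - + 2))
          ≡⟨ solve (a ∷ b ∷ p ∷ q ∷ m ∷ []) ⟩
        (a * a - (a * a - m * (b * b))) * (p * p - (p * p - m * (q * q))) - a * a * ((p - + 2) * (p - + 2))
          ≡⟨ cong₂ (λ x y → (a * a - x) * (p * p - y) - a * a * ((p - + 2) * (p - + 2))) normᵃ≡ normᵖ≡ ⟩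
        (a * a - - + 4) * (p * p - + 4) - a * a * ((p - + 2) * (p - + 2))
          ≡⟨ solve (a ∷ p ∷ []) ⟩
        (p - + 2) * (p + + 2 + a * a) * + 4 ∎

  descent : 0ℤ < m → ∀ η ε γ → + 1 ≤ v η → + 1 ≤ u ε → + 1 ≤ v ε → u ε ≤ u η →
            norm η ≡ - + 4 → norm ε ≡ + 4 → Product η (conj ε) γ →
            + 1 ≤ u γ × + 1 ≤ v γ × u γ < u η
  descent 0<m ⟨ a , b ⟩ ⟨ p , q ⟩ ⟨ c , d ⟩ 1≤b 1≤p 1≤q p≤a normᵃ≡ normᵖ≡ product =
    i<j⇒suc[i]≤j c>0 , i<j⇒suc[i]≤j d>0 , c<a
    where open Descent 0<m a b p q c d (suc[i]≤j⇒i<j 1≤b) (suc[i]≤j⇒i<j 1≤p) (suc[i]≤j⇒i<j 1≤q)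
                       p≤a normᵃ≡ normᵖ≡ product

module ZK (M : ℕ) where
  open QF M
  open Quadratic (+ M) using (norm-*; norm-conj; norm--conj; norm-one; product-one; norm-−4⇒invertible;
                         product-by-inverse; product-positive; v-even⊎4∣m-1; half-product;
                         solution-parity; descent)

  2∣u-v : ∀ α → InZK α → + 2 S.∣ u α - v α
  2∣u-v α (2∣u-v , _) = S.∣ᵤ⇒∣ 2∣u-v

  4∣4N : ∀ α → InZK α → + 4 S.∣ 4N α
  4∣4N α (_ , 4∣4N) = S.∣ᵤ⇒∣ 4∣4N

  mkInZK : ∀ α → + 2 S.∣ u α - v α → + 4 S.∣ 4N α → InZK α
  mkInZK α 2∣u-v 4∣4N = S.∣⇒∣ᵤ 2∣u-v , S.∣⇒∣ᵤ 4∣4N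

  N-exact : ∀ α k → 4N α ≡ k * + 4 → N α ≡ k
  N-exact α k 4N≡ = trans (cong (ℤ._/ + 4) 4N≡) (i*4/4≡i k)

  4N≡N*4 : ∀ α → InZK α → 4N α ≡ N α * + 4
  4N≡N*4 α α∈ with 4∣4N α α∈
  ... | S.divides q 4N≡ = trans 4N≡ (cong (_* + 4) (sym (N-exact α q 4N≡)))

  4N-*-exact : ∀ α β γ i j → IsProduct α β γ → 4N α ≡ i * + 4 → 4N β ≡ j * + 4 →
               4N γ ≡ (i * j) * + 4
  4N-*-exact α β γ i j αβ≡γ 4Nα≡ 4Nβ≡ = *-cancelʳ-≡ _ _ (+ 4) (begin
    4N γ * + 4                      ≡⟨ norm-* α β γ αβ≡γ ⟩
    4N α * 4N β                     ≡⟨ cong₂ _*_ 4Nα≡ 4Nβ≡ ⟩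
    (i * + 4) * (j * + 4)           ≡⟨ interchange i (+ 4) j (+ 4) ⟩
    (i * j) * (+ 4 * + 4)           ≡⟨ *-assoc (i * j) (+ 4) (+ 4) ⟨
    (i * j) * + 4 * + 4             ∎)

  4N-* : ∀ α β γ → InZK α → InZK β → IsProduct α β γ → 4N γ ≡ (N α * N β) * + 4
  4N-* α β γ α∈ β∈ αβ≡γ = 4N-*-exact α β γ (N α) (N β) αβ≡γ (4N≡N*4 α α∈) (4N≡N*4 β β∈)

  N-* : ∀ α β γ → InZK α → InZK β → IsProduct α β γ → N γ ≡ N α * N β
  N-* α β γ α∈ β∈ αβ≡γ = N-exact γ (N α * N β) (4N-* α β γ α∈ β∈ αβ≡γ)

  4∣[M-1]vv : ∀ α β → InZK α → InZK β → + 4 S.∣ (+ M - + 1) * (v α * v β)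
  4∣[M-1]vv α β α∈ β∈
    with v-even⊎4∣m-1 α (2∣u-v α α∈) (4∣4N α α∈) | v-even⊎4∣m-1 β (2∣u-v β β∈) (4∣4N β β∈)
  ... | inj₂ 4∣M-1 | _ = S.∣m⇒∣m*n (v α * v β) 4∣M-1
  ... | inj₁ _ | inj₂ 4∣M-1 = S.∣m⇒∣m*n (v α * v β) 4∣M-1
  ... | inj₁ (S.divides k₁ v≡₁) | inj₁ (S.divides k₂ v≡₂) =
    S.∣n⇒∣m*n (+ M - + 1) (S.divides (k₁ * k₂) (begin
    v α * v β                       ≡⟨ cong₂ _*_ v≡₁ v≡₂ ⟩
    (k₁ * + 2) * (k₂ * + 2)         ≡⟨ interchange k₁ (+ 2) k₂ (+ 2) ⟩
    (k₁ * k₂) * + 4                 ∎))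

  *-closed : ∀ α β → InZK α → InZK β → ∃ λ γ → InZK γ × IsProduct α β γ
  *-closed α β α∈ β∈ with 2∣u-v α α∈ | 2∣u-v β β∈ | 4∣[M-1]vv α β α∈ β∈
  ... | S.divides k₁ u-v≡₁ | S.divides k₂ u-v≡₂ | S.divides t [M-1]vv≡
    with half-product α β k₁ k₂ t (i-j≡k⇒i≡j+k u-v≡₁) (i-j≡k⇒i≡j+k u-v≡₂) [M-1]vv≡
  ... | γ , αβ≡γ , u-v≡ =
    γ , mkInZK γ (S.divides (t + k₁ * k₂) u-v≡) (S.divides (N α * N β) (4N-* α β γ α∈ β∈ αβ≡γ)) , αβ≡γ

  InZK-conj : ∀ α → InZK α → InZK (conj α)
  InZK-conj α@(⟨ a , b ⟩) α∈ = mkInZK (conj α)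
    (subst (+ 2 S.∣_) ((a - b + b * + 2 ≡ a - - b) ∋ solve (a ∷ b ∷ []))
      (S.∣m∣n⇒∣m+n (2∣u-v α α∈) (S.divides b refl)))
    (subst (+ 4 S.∣_) (sym (norm-conj α)) (4∣4N α α∈))

  InZK--conj : ∀ α → InZK α → InZK (-conj α)
  InZK--conj α@(⟨ a , b ⟩) α∈ = mkInZK (-conj α)
    (subst (+ 2 S.∣_) ((- (a - b) - b * + 2 ≡ - a - b) ∋ solve (a ∷ b ∷ []))
      (S.∣m∣n⇒∣m-n (S.∣m⇒∣-m (2∣u-v α α∈)) (S.divides b refl)))
    (subst (+ 4 S.∣_) (sym (norm--conj α)) (4∣4N α α∈))

  one∈ : InZK one
  one∈ = mkInZK one (S.divides (+ 1) refl) (S.divides (+ 1) norm-one)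

  Generates-refl : ∀ α → Generates α α
  Generates-refl α = (one , one∈ , product-one α) , (one , one∈ , product-one α)

  norm-−1⇒unit : ∀ η → InZK η → 4N η ≡ - + 4 → IsUnit η
  norm-−1⇒unit η η∈ 4Nη≡-4 = η∈ , -conj η , InZK--conj η η∈ , norm-−4⇒invertible η 4Nη≡-4

  solution-norm : ∀ s ν {x y} → IsSolution s ν x y → N ⟨ x , y ⟩ ≡ s * + ν
  solution-norm s ν {x} {y} (_ , _ , norm≡) = N-exact ⟨ x , y ⟩ (s * + ν) (trans norm≡ (*-comm (+ 4) (s * + ν)))

  IsSolution? : ∀ s ν x y → Dec (IsSolution s ν x y)
  IsSolution? s ν x y = (+ 1 ≤? x) ×-dec (+ 1 ≤? y) ×-dec (x * x - + M * (y * y) ℤ.≟ + 4 * (s * + ν))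

  HasGenerator⁺ : 𝕂 → ℤ → Set
  HasGenerator⁺ α n = ∃ λ β → InZK⁺ β × Generates α β × N β ≡ n

  PrincipalIdealWithGenerator⁺ : ℤ → ℕ → Set
  PrincipalIdealWithGenerator⁺ s ν =
    Σ 𝕂 λ γ → InZK γ × idealNorm γ ≡ ν × Σ 𝕂 λ α → InZK⁺ α × Generates γ α × sign (N α) ≡ sign s

  associate-by-unit : ∀ ε α → InZK⁺ ε → 4N ε ≡ - + 4 → InZK⁺ α →
               HasGenerator⁺ α (N α * N ε)
  associate-by-unit ε α (ε∈ , 1≤p , 1≤q) 4Nε≡-4 (α∈ , 1≤a , 1≤b) =
    let β , β∈ , αε≡β = *-closed α ε α∈ ε∈
        1≤c , 1≤d = product-positive (+≤+ ℕ.z≤n) α ε β 1≤a 1≤b 1≤p 1≤q αε≡β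
        βε⁻¹≡α : IsProduct β (-conj ε) α
        βε⁻¹≡α = product-by-inverse α ε (-conj ε) β αε≡β (norm-−4⇒invertible ε 4Nε≡-4)
    in β , (β∈ , 1≤c , 1≤d) , ((ε , ε∈ , αε≡β) , (-conj ε , InZK--conj ε ε∈ , βε⁻¹≡α)) ,
       N-* α ε β α∈ ε∈ αε≡β

  Generates⇒idealNorm≡ : ∀ γ α → InZK γ → InZK α → Generates γ α → idealNorm γ ≢ 0 →
                         idealNorm α ≡ idealNorm γ
  Generates⇒idealNorm≡ γ α γ∈ α∈ ((x , x∈ , γx≡α) , (y , y∈ , αy≡γ)) ∣Nγ∣≢0 = begin
    idealNorm α                       ≡⟨ ∣Nα∣≡ ⟩
    idealNorm γ ℕ.* idealNorm x       ≡⟨ cong (idealNorm γ ℕ.*_) ∣Nx∣≡1 ⟩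
    idealNorm γ ℕ.* 1                 ≡⟨ ℕ.*-identityʳ (idealNorm γ) ⟩
    idealNorm γ                       ∎
    where
    ∣Nα∣≡ : idealNorm α ≡ idealNorm γ ℕ.* idealNorm x
    ∣Nα∣≡ = trans (cong ∣_∣ (N-* γ x α γ∈ x∈ γx≡α)) (abs-* (N γ) (N x))
    ∣Nγ∣≡ : idealNorm γ ≡ idealNorm α ℕ.* idealNorm y
    ∣Nγ∣≡ = trans (cong ∣_∣ (N-* α y γ α∈ y∈ αy≡γ)) (abs-* (N α) (N y))
    ∣Nx∣≡1 : idealNorm x ≡ 1
    ∣Nx∣≡1 = ℕ.m*n≡1⇒m≡1 (idealNorm x) (idealNorm y)
      (sym (ℕ.*-cancelˡ-≡ 1 (idealNorm x ℕ.* idealNorm y) (idealNorm γ) {{ℕ.≢-nonZero ∣Nγ∣≢0}} (begin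
        idealNorm γ ℕ.* 1                                   ≡⟨ ℕ.*-identityʳ (idealNorm γ) ⟩
        idealNorm γ                                         ≡⟨ ∣Nγ∣≡ ⟩
        idealNorm α ℕ.* idealNorm y                         ≡⟨ cong (ℕ._* idealNorm y) ∣Nα∣≡ ⟩
        idealNorm γ ℕ.* idealNorm x ℕ.* idealNorm y         ≡⟨ ℕ.*-assoc (idealNorm γ) _ _ ⟩
        idealNorm γ ℕ.* (idealNorm x ℕ.* idealNorm y)       ∎)))

  generator-of-any-sign : ∀ ε → InZK⁺ ε → N ε ≡ -1ℤ → IsSign s → IsSign s' →
                          ∀ ν α → InZK⁺ α → N α ≡ s' * + ν → HasGenerator⁺ α (s * + ν)
  generator-of-any-sign {s} {s'} ε ε⁺@(ε∈ , _) Nε≡-1 s± s'± ν α α⁺ Nα≡ with sign-dichotomy s± s'±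
  ... | inj₁ refl = α , α⁺ , Generates-refl α , Nα≡
  ... | inj₂ refl =
    let β , β⁺ , α~β , Nβ≡ = associate-by-unit ε α ε⁺ (trans (4N≡N*4 ε ε∈) (cong (_* + 4) Nε≡-1)) α⁺
    in β , β⁺ , α~β , (begin
      N β                     ≡⟨ Nβ≡ ⟩
      N α * N ε               ≡⟨ cong₂ _*_ Nα≡ Nε≡-1 ⟩
      s' * + ν * -1ℤ          ≡⟨ *-comm (s' * + ν) -1ℤ ⟩
      -1ℤ * (s' * + ν)        ≡⟨ -1*i≡-i (s' * + ν) ⟩
      - (s' * + ν)            ≡⟨ neg-distribˡ-* s' (+ ν) ⟩
      - s' * + ν              ∎)

  module _ (1≤M : 1 ℕ.≤ M) where

    private instance
      M≢0 : ℕ.NonZero M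
      M≢0 = ℕ.>-nonZero 1≤M

    solution-bound : ∀ s ν x n → IsSolution s ν x (+ n) → n ℕ.≤ ∣ x * x - + 4 * (s * + ν) ∣
    solution-bound s ν x n (_ , 1≤n , norm≡) =
      ℕ.≤-trans (ℕ.m≤m*n n n {{ℕ.>-nonZero (drop‿+≤+ 1≤n)}})
        (ℕ.≤-trans (ℕ.m≤n*m (n ℕ.* n) M) (ℕ.≤-reflexive M*n*n≡))
      where
      M*n*n≡ : M ℕ.* (n ℕ.* n) ≡ ∣ x * x - + 4 * (s * + ν) ∣
      M*n*n≡ = trans (cong (M ℕ.*_) (sym (abs-* (+ n) (+ n))))
                 (trans (sym (abs-* (+ M) (+ n * + n)))
                   (cong ∣_∣ (i-j≡k⇒j≡i-k {x * x} {+ M * (+ n * + n)} norm≡)))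

    solvable? : ∀ s ν → Decidable (λ t → ∃ (IsSolution s ν (+ t)))
    solvable? s ν t
      with ℕ.anyUpTo? (λ n → IsSolution? s ν (+ t) (+ n)) (ℕ.suc ∣ + t * + t - + 4 * (s * + ν) ∣)
    ... | yes (n , _ , sol) = yes (+ n , sol)
    ... | no ∄n = no λ where
      (+ n , sol) → ∄n (n , ℕ.s≤s (solution-bound s ν (+ t) n sol) , sol)
      (-[1+ _ ] , _ , () , _)

    trace-norm-injective : ∀ β γ → InZK β → InZK γ → + 1 ≤ v β → + 1 ≤ v γ →
                           N β ≡ N γ → T β ≡ T γ → β ≡ γ
    trace-norm-injective β γ β∈ γ∈ 1≤vβ 1≤vγ Nβ≡Nγ Tβ≡Tγ = cong₂ ⟨_,_⟩ Tβ≡Tγ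
      (square-injective (suc[i]≤j⇒i<j 1≤vβ) (suc[i]≤j⇒i<j 1≤vγ) (*-cancelˡ-≡ (+ M) _ _ Mvβ²≡Mvγ²))
      where
      4Nβ≡4Nγ : 4N β ≡ 4N γ
      4Nβ≡4Nγ = trans (4N≡N*4 β β∈) (trans (cong (_* + 4) Nβ≡Nγ) (sym (4N≡N*4 γ γ∈)))
      Mvβ²≡Mvγ² : + M * (v β * v β) ≡ + M * (v γ * v γ)
      Mvβ²≡Mvγ² = begin
        + M * (v β * v β)         ≡⟨ i-j≡k⇒j≡i-k {u β * u β} refl ⟩
        u β * u β - 4N β          ≡⟨ cong₂ (λ x y → x * x - y) Tβ≡Tγ 4Nβ≡4Nγ ⟩
        u γ * u γ - 4N γ          ≡⟨ i-j≡k⇒j≡i-k {u γ * u γ} refl ⟨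
        + M * (v γ * v γ)         ∎

    fundamental-solution : ∀ s ν {x y} → IsSolution s ν x y → ∃₂ (IsFundamentalSolution s ν)
    fundamental-solution s ν {+ _} {y} sol with least-witness (solvable? s ν) (y , sol)
    ... | x₀ , (y₀ , sol₀) , least = + x₀ , y₀ , sol₀ , λ where
      (+ _) y' sol' → +≤+ (least (y' , sol'))
      -[1+ _ ] _ (() , _)

  module _ (2≤M : 2 ℕ.≤ M) (sqf : SquareFree M) where

    private
      1≤M : 1 ℕ.≤ M
      1≤M = ℕ.≤-trans (ℕ.s≤s ℕ.z≤n) 2≤M

      0<M : 0ℤ < + M
      0<M = +<+ 1≤M

      instance
        M≢0 : ℕ.NonZero M
        M≢0 = ℕ.>-nonZero 1≤M

    4∤M : ¬ (+ 4 S.∣ + M)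
    4∤M 4∣M with sqf 2 (S.∣⇒∣ᵤ 4∣M)
    ... | ()

    4∣4N⇒InZK : ∀ α → + 4 S.∣ 4N α → InZK α
    4∣4N⇒InZK α 4∣4N = mkInZK α (solution-parity 4∤M α 4∣4N) 4∣4N

    M*n²≢4 : ∀ n → M ℕ.* (n ℕ.* n) ≢ 4
    M*n²≢4 0 M*0≡4 with trans (sym (ℕ.*-zeroʳ M)) M*0≡4
    ... | ()
    M*n²≢4 1 M*1≡4 with sqf 2 (ℕ.divides 1 (trans (sym (ℕ.*-identityʳ M)) M*1≡4))
    ... | ()
    M*n²≢4 (ℕ.suc (ℕ.suc k)) M*n²≡4 = ℕ.<-irrefl (sym M*n²≡4)
      (ℕ.≤-trans (ℕ.s≤s (ℕ.s≤s (ℕ.s≤s (ℕ.s≤s (ℕ.s≤s ℕ.z≤n)))))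
        (ℕ.*-mono-≤ 2≤M (ℕ.*-mono-≤ (ℕ.s≤s (ℕ.s≤s (ℕ.z≤n {k}))) (ℕ.s≤s (ℕ.s≤s (ℕ.z≤n {k}))))))

    norm-−4⇒positive-solution : ∀ x y → x * x - + M * (y * y) ≡ - + 4 →
                                IsSolution -1ℤ 1 (+ ∣ x ∣) (+ ∣ y ∣)
    norm-−4⇒positive-solution x y norm≡ =
      1≤∣i∣ x x≢0 , 1≤∣i∣ y y≢0 ,
      trans (cong₂ (λ i j → i - + M * j) (∣i∣*∣i∣≡i*i x) (∣i∣*∣i∣≡i*i y)) norm≡
      where
      x≢0 : x ≢ 0ℤ
      x≢0 refl = M*n²≢4 ∣ y ∣ (+-injective (begin
        + (M ℕ.* (∣ y ∣ ℕ.* ∣ y ∣))      ≡⟨ pos-* M (∣ y ∣ ℕ.* ∣ y ∣) ⟩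
        + M * + (∣ y ∣ ℕ.* ∣ y ∣)        ≡⟨ cong (+ M *_) (trans (pos-* ∣ y ∣ ∣ y ∣) (∣i∣*∣i∣≡i*i y)) ⟩
        + M * (y * y)                    ≡⟨ neg-injective (trans (sym (+-identityˡ _)) norm≡) ⟩
        + 4                              ∎))
      y≢0 : y ≢ 0ℤ
      y≢0 refl with ≤-trans (i*i≥0 x) (≤-reflexive (begin
        x * x                            ≡⟨ +-identityʳ (x * x) ⟨
        x * x + 0ℤ                       ≡⟨ cong (λ z → x * x - z) (*-zeroʳ (+ M)) ⟨
        x * x - + M * (0ℤ * 0ℤ)          ≡⟨ norm≡ ⟩
        - + 4                            ∎))
      ... | ()

    descent-step : ∀ ε → IsFundamentalUnit ε → 4N ε ≡ + 4 →
                   ∀ {a b} → IsSolution -1ℤ 1 a b → ∃₂ λ c d → IsSolution -1ℤ 1 c d × c < a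
    descent-step ε ((ε∈ , _) , (_ , 1≤p , 1≤q) , ε-least) 4Nε≡4 {a} {b} (1≤a , 1≤b , 4Nη≡-4) =
      let γ , _ , ηε̄≡γ = *-closed η (conj ε) η∈ (InZK-conj ε ε∈)
          1≤c , 1≤d , c<a = descent 0<M η ε γ 1≤b 1≤p 1≤q p≤a 4Nη≡-4 4Nε≡4 ηε̄≡γ
          4Nγ≡-4 : 4N γ ≡ - + 4
          4Nγ≡-4 = 4N-*-exact η (conj ε) γ -1ℤ 1ℤ ηε̄≡γ 4Nη≡-4 (trans (norm-conj ε) 4Nε≡4)
      in u γ , v γ , (1≤c , 1≤d , 4Nγ≡-4) , c<a
      where
      η : 𝕂
      η = ⟨ a , b ⟩
      η∈ : InZK η
      η∈ = 4∣4N⇒InZK η (S.divides -1ℤ 4Nη≡-4)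
      p≤a : u ε ≤ a
      p≤a = ε-least η (norm-−1⇒unit η η∈ 4Nη≡-4) (η∈ , 1≤a , 1≤b)

    no-positive-solution-−4 : ∀ ε → IsFundamentalUnit ε → 4N ε ≡ + 4 →
                              ∀ {x y} → ¬ IsSolution -1ℤ 1 x y
    no-positive-solution-−4 ε fu 4Nε≡4 sol =
      let a , b , sol₀ , least = fundamental-solution 1≤M -1ℤ 1 sol
          c , d , sol₁ , c<a = descent-step ε fu 4Nε≡4 sol₀
      in <-irrefl refl (<-≤-trans c<a (least c d sol₁))

    no-norm-−1 : ∀ ε → IsFundamentalUnit ε → N ε ≡ 1ℤ → ∀ ξ → InZK ξ → N ξ ≢ -1ℤ
    no-norm-−1 ε fu@((ε∈ , _) , _) Nε≡1 ξ ξ∈ Nξ≡-1 =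
      no-positive-solution-−4 ε fu (trans (4N≡N*4 ε ε∈) (cong (_* + 4) Nε≡1))
        (norm-−4⇒positive-solution (u ξ) (v ξ) (trans (4N≡N*4 ξ ξ∈) (cong (_* + 4) Nξ≡-1)))

    solution⇒InZK : ∀ s ν {x y} → IsSolution s ν x y → InZK ⟨ x , y ⟩
    solution⇒InZK s ν {x} {y} (_ , _ , norm≡) =
      4∣4N⇒InZK ⟨ x , y ⟩ (S.divides (s * + ν) (trans norm≡ (*-comm (+ 4) (s * + ν))))

    generator-sign-forced : ∀ ε → IsFundamentalUnit ε → N ε ≡ 1ℤ → IsSign s → IsSign s' →
                            ∀ ν .{{_ : ℕ.NonZero ν}} α → InZK α → N α ≡ s' * + ν →
                            HasGenerator⁺ α (s * + ν) → s' ≡ s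
    generator-sign-forced {s} {s'} ε fu Nε≡1 s± s'± ν α α∈ Nα≡ (β , _ , ((x , x∈ , αx≡β) , _) , Nβ≡)
      with sign-dichotomy s± s'±
    ... | inj₁ s'≡s = s'≡s
    ... | inj₂ refl = contradiction Nx≡-1 (no-norm-−1 ε fu Nε≡1 x x∈)
      where
      instance
        s'ν≢0 : ℤ.NonZero (s' * + ν)
        s'ν≢0 = ℕ.≢-nonZero (λ ∣s'ν∣≡0 → ℕ.≢-nonZero⁻¹ ν (trans (sym (∣s*ν∣≡ν s'± ν)) ∣s'ν∣≡0))
      Nx≡-1 : N x ≡ -1ℤ
      Nx≡-1 = *-cancelˡ-≡ (s' * + ν) (N x) -1ℤ (begin
        s' * + ν * N x          ≡⟨ cong (_* N x) Nα≡ ⟨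
        N α * N x               ≡⟨ N-* α x β α∈ x∈ αx≡β ⟨
        N β                     ≡⟨ Nβ≡ ⟩
        - s' * + ν              ≡⟨ neg-distribˡ-* s' (+ ν) ⟨
        - (s' * + ν)            ≡⟨ -1*i≡-i (s' * + ν) ⟨
        -1ℤ * (s' * + ν)        ≡⟨ *-comm -1ℤ (s' * + ν) ⟩
        s' * + ν * -1ℤ          ∎)

    fundamental-solution⇒generator : IsSign s → ∀ ν .{{_ : ℕ.NonZero ν}} →
      ∃₂ (IsFundamentalSolution s ν) → PrincipalIdealWithGenerator⁺ s ν
    fundamental-solution⇒generator {s} s± ν (x , y , sol@(1≤x , 1≤y , _) , _) =
      ξ , ξ∈ , trans (cong ∣_∣ Nξ≡) (∣s*ν∣≡ν s± ν) ,
      ξ , (ξ∈ , 1≤x , 1≤y) , Generates-refl ξ , trans (cong sign Nξ≡) (sign[s*ν]≡sign[s] s± ν)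
      where
      ξ : 𝕂
      ξ = ⟨ x , y ⟩
      ξ∈ : InZK ξ
      ξ∈ = solution⇒InZK s ν sol
      Nξ≡ : N ξ ≡ s * + ν
      Nξ≡ = solution-norm s ν sol

    generator⇒fundamental-solution : IsSign s → ∀ ν .{{_ : ℕ.NonZero ν}} →
      PrincipalIdealWithGenerator⁺ s ν → ∃₂ (IsFundamentalSolution s ν)
    generator⇒fundamental-solution {s} s± ν (γ , γ∈ , ∣Nγ∣≡ν , α , (α∈ , 1≤a , 1≤b) , γ~α , sign≡) =
      fundamental-solution 1≤M s ν (1≤a , 1≤b , 4Nα≡)
      where
      ∣Nα∣≡ν : idealNorm α ≡ ν
      ∣Nα∣≡ν = trans (Generates⇒idealNorm≡ γ α γ∈ α∈ γ~α (subst (_≢ 0) (sym ∣Nγ∣≡ν) (ℕ.≢-nonZero⁻¹ ν)))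
                     ∣Nγ∣≡ν
      Nα≡ : N α ≡ s * + ν
      Nα≡ = trans (sym (signᵢ◃∣i∣≡i (N α))) (trans (cong₂ ℤ._◃_ sign≡ ∣Nα∣≡ν) (sign[s]◃ν≡s*ν s± ν))
      4Nα≡ : 4N α ≡ + 4 * (s * + ν)
      4Nα≡ = trans (4N≡N*4 α α∈) (trans (cong (_* + 4) Nα≡) (*-comm (s * + ν) (+ 4)))

    first-occurrence : ∀ s ν x y → IsFundamentalSolution s ν x y →
      IsFirstOccurrence M s ν x ×
      ((r : ℤ) → + 1 ≤ r → x * x - + 4 * (s * + ν) ≡ + M * (r * r) → y ≡ r)
    first-occurrence s ν x (+ n) ((1≤x , 1≤y , norm≡) , least) =
      (1≤x , (sqf , n , drop‿+≤+ 1≤y , x²-4sν≡) , minimal) , determined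
      where
      x²-4sν≡ : x * x - + 4 * (s * + ν) ≡ + M * (+ n * + n)
      x²-4sν≡ = sym (i-j≡k⇒j≡i-k {x * x} norm≡)
      minimal : (t : ℤ) → + 1 ≤ t → IsSqfreePart (t * t - + 4 * (s * + ν)) (+ M) → x ≤ t
      minimal t 1≤t (_ , k , 1≤k , t²-4sν≡) =
        least t (+ k) (1≤t , +≤+ 1≤k , sym (i-j≡k⇒j≡i-k {t * t} t²-4sν≡))
      determined : (r : ℤ) → + 1 ≤ r → x * x - + 4 * (s * + ν) ≡ + M * (r * r) → + n ≡ r
      determined r 1≤r x²-4sν≡′ = square-injective (suc[i]≤j⇒i<j 1≤y) (suc[i]≤j⇒i<j 1≤r)
        (*-cancelˡ-≡ (+ M) _ _ (trans (sym x²-4sν≡) x²-4sν≡′))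

theorem4p6 :
  (M : ℕ) → 2 ℕ.≤ M → SquareFree M →
  (ε : 𝕂) → QF.IsFundamentalUnit M ε →
  (s : ℤ) → (s ≡ 1ℤ ⊎ s ≡ -1ℤ) →
  (ν : ℕ) → 2 ℕ.≤ ν →
  -- (i) existence of a fundamental solution  ⇔  existence of a principal ideal of norm ν
  --     with a generator in Z_K^+ whose norm has sign s
  ((Σ ℤ λ x → Σ ℤ λ y → QF.IsFundamentalSolution M s ν x y)
    ⇔ (Σ 𝕂 λ γ → QF.InZK M γ × QF.idealNorm M γ ≡ ν ×
         Σ 𝕂 λ α → QF.InZK⁺ M α × QF.Generates M γ α × sign (QF.N M α) ≡ sign s))
  ×
  -- (i) moreover: for a = (α), α ∈ Z_K^+, N(α) = s' ν
  ((α : 𝕂) → QF.InZK⁺ M α → QF.idealNorm M α ≡ ν →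
   (s' : ℤ) → (s' ≡ 1ℤ ⊎ s' ≡ -1ℤ) → QF.N M α ≡ s' * + ν →
     (QF.N M ε ≡ -1ℤ →
        Σ 𝕂 λ β → QF.InZK⁺ M β × QF.Generates M α β × QF.N M β ≡ s * + ν)
     ×
     (QF.N M ε ≡ 1ℤ →
        ((Σ 𝕂 λ β → QF.InZK⁺ M β × QF.Generates M α β × QF.N M β ≡ s * + ν) ⇔ (s' ≡ s))))
  ×
  -- (ii) uniqueness: generators of a = (α) in Z_K^+ of norm s ν with equal trace coincide
  ((α : 𝕂) → QF.InZK⁺ M α → QF.N M α ≡ s * + ν →
   (β γ : 𝕂) → QF.InZK⁺ M β → QF.Generates M α β → QF.N M β ≡ s * + ν →
               QF.InZK⁺ M γ → QF.Generates M α γ → QF.N M γ ≡ s * + ν →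
               QF.T M β ≡ QF.T M γ → β ≡ γ)
  ×
  -- (ii) first occurrence: the fundamental solution (u, v) has u = least t ≥ 1 with
  --      sqfree(t² − 4 s ν) = M, and v = r where u² − 4 s ν = M r², r ≥ 1
  ((x y : ℤ) → QF.IsFundamentalSolution M s ν x y →
     IsFirstOccurrence M s ν x ×
     ((r : ℤ) → + 1 ≤ r → x * x - + 4 * (s * + ν) ≡ + M * (r * r) → y ≡ r))
theorem4p6 M 2≤M sqf ε fu@(_ , ε⁺ , _) s s± ν 2≤ν =
  mk⇔ (fundamental-solution⇒generator 2≤M sqf s± ν) (generator⇒fundamental-solution 2≤M sqf s± ν) ,
  (λ α α⁺ _ s' s'± Nα≡ →
    (λ Nε≡-1 → generator-of-any-sign ε ε⁺ Nε≡-1 s± s'± ν α α⁺ Nα≡) ,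
    (λ Nε≡1 → mk⇔ (generator-sign-forced 2≤M sqf ε fu Nε≡1 s± s'± ν α (proj₁ α⁺) Nα≡)
                  (λ s'≡s → α , α⁺ , Generates-refl α , trans Nα≡ (cong (_* + ν) s'≡s)))) ,
  -- trace and norm alone determine an element of Z_K^+
  (λ _ _ _ β γ (β∈ , _ , 1≤vβ) _ Nβ≡ (γ∈ , _ , 1≤vγ) _ Nγ≡ →
    trace-norm-injective 1≤M β γ β∈ γ∈ 1≤vβ 1≤vγ (trans Nβ≡ (sym Nγ≡))) ,
  first-occurrence 2≤M sqf s ν
  where
  open ZK M
  1≤M : 1 ℕ.≤ M
  1≤M = ℕ.≤-trans (ℕ.s≤s ℕ.z≤n) 2≤M
  instance
    ν≢0 : ℕ.NonZero ν
    ν≢0 = ℕ.>-nonZero (ℕ.≤-trans (ℕ.s≤s ℕ.z≤n) 2≤ν)
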